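{- For every integer $n \ge 2$, in the edge-distinguishing game (EDGe) played on the complete graph $K_n$ (with $\lambda(K_n)$ colors), Player 2 has a winning strategy.
   Context: All graphs are finite and simple. For a positive integer $k$ let $[k]=\{1,\dots,k\}$. A $k$-coloring of a graph $G$ is a map $c:V(G)\to[k]$; it induces the edge coloring $c'(\{u,v\})=\{c(u),c(v)\}$, a 2-element multiset of colors. The coloring $c$ is edge-distinguishing if $c'$ is injective, and the edge-distinguishing chromatic number $\lambda(G)$ is the least $k$ for which an edge-distinguishing $k$-coloring of $G$ exists. A partial coloring is a map $c:U\to[k]$ with $U\subseteq V(G)$; its partial induced edge coloring is the induced edge coloring on the induced subgraph $G[U]$ (edges with both endpoints colored). EDGe on $G$: two players, Player 1 moving first, alternately choose an uncolored vertex and give it a color from $[\lambda(G)]$; a move is legal iff after it the partial induced edge coloring of the colored vertices is injective. The player making the last legal move wins (a player with no legal move loses). A player has a winning strategy if they can guarantee a win regardless of the opponent's moves. -}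

module Defs where

open import Data.Nat using (ℕ; _<_)
open import Data.Fin using (Fin; _≟_)
open import Data.Maybe using (Maybe; just; nothing)
open import Data.Product using (Σ; _×_; _,_)
open import Data.Sum using (_⊎_)
open import Data.Empty using (⊥)
open import Relation.Nullary using (¬_; yes; no)
open import Relation.Binary.PropositionalEquality using (_≡_; _≢_)

record Graph : Set₁ where
  field
    n       : ℕ
    Adj     : Fin n → Fin n → Set
    symm    : ∀ {u v} → Adj u v → Adj v u
    irrefl  : ∀ {u} → Adj u u → ⊥
open Graph public

K : ℕ → Graph
K m = record
  { n = m
  ; Adj = λ u v → u ≢ v
  ; symm = λ u≢v v≡u → u≢v (sym' v≡u)
  ; irrefl = λ u≢u → u≢u Relation.Binary.PropositionalEquality.refl
  }
  where
    sym' = Relation.Binary.PropositionalEquality.sym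

SameMultiset : {A : Set} → A → A → A → A → Set
SameMultiset a b a' b' = (a ≡ a' × b ≡ b') ⊎ (a ≡ b' × b ≡ a')

EdgeDistinguishing : (G : Graph) (k : ℕ) → (Fin (n G) → Fin k) → Set
EdgeDistinguishing G k c =
  ∀ u v x y → Adj G u v → Adj G x y →
  SameMultiset (c u) (c v) (c x) (c y) → SameMultiset u v x y

IsLambda : Graph → ℕ → Set
IsLambda G k =
  Σ (Fin (n G) → Fin k) (EdgeDistinguishing G k) ×
  (∀ j → j < k → ¬ Σ (Fin (n G) → Fin j) (EdgeDistinguishing G j))

-- Partial colorings: nothing = uncolored.
Position : Graph → ℕ → Set
Position G k = Fin (n G) → Maybe (Fin k)

PartialEdgeDistinguishing : (G : Graph) (k : ℕ) → Position G k → Set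
PartialEdgeDistinguishing G k p =
  ∀ u v x y a b a' b' → Adj G u v → Adj G x y →
  p u ≡ just a → p v ≡ just b → p x ≡ just a' → p y ≡ just b' →
  SameMultiset a b a' b' → SameMultiset u v x y

play : (G : Graph) (k : ℕ) → Position G k → Fin (n G) → Fin k → Position G k
play G k p v c w with w ≟ v
... | yes _ = just c
... | no  _ = p w

LegalMove : (G : Graph) (k : ℕ) → Position G k → Fin (n G) → Fin k → Set
LegalMove G k p v c = p v ≡ nothing × PartialEdgeDistinguishing G k (play G k p v c)

-- Normal-play game (last legal move wins). Inductive, i.e. well-founded:
-- Wins p  : the player to move at p has a winning strategy;
-- Loses p : the player to move at p loses against best play (every legal
--           move leads to a position winning for the opponent).
mutual
  data Wins (G : Graph) (k : ℕ) (p : Position G k) : Set where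
    move : (v : Fin (n G)) (c : Fin k) → LegalMove G k p v c →
           Loses G k (play G k p v c) → Wins G k p

  data Loses (G : Graph) (k : ℕ) (p : Position G k) : Set where
    allMoves : ((v : Fin (n G)) (c : Fin k) → LegalMove G k p v c →
                Wins G k (play G k p v c)) → Loses G k p

start : (G : Graph) (k : ℕ) → Position G k
start G k _ = nothing

Player2Wins : Graph → ℕ → Set
Player2Wins G k = Loses G k (start G k)

{-# OPTIONS --safe #-}
module Submission where

-- Player 2 answers Player 1's first move by giving the same colour to another vertex.
-- Then any further vertex z, coloured d, would give its edges to the two copies the same
-- colour pair {c, d}; in K_m every vertex is adjacent to both copies, so no legal move is
-- left.

open import Defs
open import Data.Nat using (ℕ; _≤_; suc; s≤s; z≤n)
open import Data.Fin using (Fin; _≟_; zero; punchIn)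
open import Data.Fin.Properties using (punchInᵢ≢i)
open import Data.Maybe using (just; nothing)
open import Data.Product using (_×_; _,_)
open import Data.Sum using (_⊎_; inj₁; inj₂)
open import Relation.Nullary using (¬_; yes; no; contradiction)
open import Relation.Binary.PropositionalEquality

SameMultiset-sym : {A : Set} {a b a' b' : A} →
                   SameMultiset a b a' b' → SameMultiset a' b' a b
SameMultiset-sym (inj₁ (refl , refl)) = inj₁ (refl , refl)
SameMultiset-sym (inj₂ (refl , refl)) = inj₂ (refl , refl)

SameMultiset-trans : {A : Set} {a b a' b' a'' b'' : A} →
                     SameMultiset a b a' b' → SameMultiset a' b' a'' b'' →
                     SameMultiset a b a'' b''
SameMultiset-trans (inj₁ (refl , refl)) s                    = s
SameMultiset-trans (inj₂ (refl , refl)) (inj₁ (refl , refl)) = inj₂ (refl , refl)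
SameMultiset-trans (inj₂ (refl , refl)) (inj₂ (refl , refl)) = inj₁ (refl , refl)

distinctWithinPair⇒SameMultiset : {A : Set} {u u' v w : A} → u ≢ u' →
                                  u ≡ v ⊎ u ≡ w → u' ≡ v ⊎ u' ≡ w →
                                  SameMultiset u u' v w
distinctWithinPair⇒SameMultiset u≢u' (inj₁ refl) (inj₁ refl) = contradiction refl u≢u'
distinctWithinPair⇒SameMultiset u≢u' (inj₁ refl) (inj₂ refl) = inj₁ (refl , refl)
distinctWithinPair⇒SameMultiset u≢u' (inj₂ refl) (inj₁ refl) = inj₂ (refl , refl)
distinctWithinPair⇒SameMultiset u≢u' (inj₂ refl) (inj₂ refl) = contradiction refl u≢u'

module Moves (G : Graph) (k : ℕ) where

  adj⇒≢ : ∀ {u v} → Adj G u v → u ≢ v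
  adj⇒≢ uv refl = irrefl G uv

  play-≡ : ∀ p v c → play G k p v c v ≡ just c
  play-≡ p v c with v ≟ v
  ... | yes _   = refl
  ... | no v≢v = contradiction refl v≢v

  play-≢ : ∀ p v c {x} → x ≢ v → play G k p v c x ≡ p x
  play-≢ p v c {x} x≢v with x ≟ v
  ... | yes x≡v = contradiction x≡v x≢v
  ... | no _    = refl

  play-coloured : ∀ p v c {x a} → play G k p v c x ≡ just a → x ≡ v ⊎ p x ≡ just a
  play-coloured p v c {x} px≡a with x ≟ v
  ... | yes x≡v = inj₁ x≡v
  ... | no _    = inj₂ px≡a

  colouredWithinPair⇒PartialEdgeDistinguishing :
    ∀ {p v w} → (∀ x {a} → p x ≡ just a → x ≡ v ⊎ x ≡ w) →
    PartialEdgeDistinguishing G k p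
  colouredWithinPair⇒PartialEdgeDistinguishing within u u' x y _ _ _ _ uu' xy pu pu' px py _ =
    SameMultiset-trans
      (distinctWithinPair⇒SameMultiset (adj⇒≢ uu') (within u pu) (within u' pu'))
      (SameMultiset-sym (distinctWithinPair⇒SameMultiset (adj⇒≢ xy) (within x px) (within y py)))

  sameColouredNeighbours⇒¬PartialEdgeDistinguishing :
    ∀ {p v w z c d} → v ≢ w → Adj G v z → Adj G w z →
    p v ≡ just c → p w ≡ just c → p z ≡ just d → ¬ PartialEdgeDistinguishing G k p
  sameColouredNeighbours⇒¬PartialEdgeDistinguishing v≢w vz wz pv pw pz distinguishing
    with distinguishing _ _ _ _ _ _ _ _ vz wz pv pz pw pz (inj₁ (refl , refl))
  ... | inj₁ (v≡w , _)     = v≢w v≡w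
  ... | inj₂ (v≡z , z≡w)   = v≢w (trans v≡z z≡w)

  noLegalMove⇒Loses : ∀ {p} → (∀ v c → ¬ LegalMove G k p v c) → Loses G k p
  noLegalMove⇒Loses stuck = allMoves λ v c legal → contradiction legal (stuck v c)

  sameColouredDominatingPair⇒Loses :
    ∀ {p v w c} → v ≢ w → p v ≡ just c → p w ≡ just c →
    (∀ z → z ≢ v → z ≢ w → Adj G v z × Adj G w z) → Loses G k p
  sameColouredDominatingPair⇒Loses {p} {v} {w} v≢w pv pw dominating =
    noLegalMove⇒Loses λ z d (pz , distinguishing) →
      let (vz , wz) = dominating z (colouredIsNot pv pz) (colouredIsNot pw pz)
      in  sameColouredNeighbours⇒¬PartialEdgeDistinguishing v≢w vz wz
            (trans (play-≢ p z d (adj⇒≢ vz)) pv)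
            (trans (play-≢ p z d (adj⇒≢ wz)) pw)
            (play-≡ p z d)
            distinguishing
    where
    colouredIsNot : ∀ {x z c} → p x ≡ just c → p z ≡ nothing → z ≢ x
    colouredIsNot px pz refl with trans (sym px) pz
    ... | ()

  twoCopies : Fin (n G) → Fin (n G) → Fin k → Position G k
  twoCopies v w c = play G k (play G k (start G k) v c) w c

  twoCopies-colouredWithinPair : ∀ v w c x {a} → twoCopies v w c x ≡ just a → x ≡ v ⊎ x ≡ w
  twoCopies-colouredWithinPair v w c x eq with play-coloured _ w c eq
  ... | inj₁ x≡w = inj₂ x≡w
  ... | inj₂ eq′ with play-coloured (start G k) v c eq′
  ...   | inj₁ x≡v = inj₁ x≡v
  ...   | inj₂ ()

  copyColour-legal : ∀ {v w} c → w ≢ v → LegalMove G k (play G k (start G k) v c) w c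
  copyColour-legal c w≢v =
    play-≢ (start G k) _ c w≢v ,
    colouredWithinPair⇒PartialEdgeDistinguishing (twoCopies-colouredWithinPair _ _ c)

  twoCopies-Loses : ∀ {v w} c → v ≢ w →
                    (∀ z → z ≢ v → z ≢ w → Adj G v z × Adj G w z) →
                    Loses G k (twoCopies v w c)
  twoCopies-Loses {v} {w} c v≢w =
    sameColouredDominatingPair⇒Loses v≢w
      (trans (play-≢ _ w c v≢w) (play-≡ (start G k) v c))
      (play-≡ _ w c)

theorem3p2 : (m : ℕ) → 2 ≤ m → (k : ℕ) → IsLambda (K m) k → Player2Wins (K m) k
theorem3p2 (suc (suc m)) (s≤s (s≤s z≤n)) k _ = allMoves λ v c _ →
  let w   = punchIn v zero
      w≢v = punchInᵢ≢i v zero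
  in  move w c (copyColour-legal c w≢v)
        (twoCopies-Loses c (≢-sym w≢v) λ z z≢v z≢w → ≢-sym z≢v , ≢-sym z≢w)
  where open Moves (K (suc (suc m))) k
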